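{- Let $k\ge 1$ be an integer and let $\mathcal{D}_k$ denote the set of Dyck paths of length $2k$. For $p\in\mathcal{D}_k$ and $0\le i\le k$, let $V_i(p)$ be the number of vertices of $p$ at altitude $i$, and let $\vec V(p)=(V_0(p),\dots,V_k(p))$. Let $E$ denote expectation with respect to the uniform distribution on $\mathcal{D}_k$. Then \[ \| E[\vec{V}]\|_2^2 \;=\; \frac{1}{C_k^2}\sum_{p_1,p_2\in\mathcal{D}_k}\sum_{i=0}^{k} V_i(p_1)V_i(p_2) \;=\; \frac{C_{2k+1}}{C_k^2}, \] where $C_m=\frac{1}{m+1}\binom{2m}{m}$ is the $m$-th Catalan number.
   Context: A Dyck path of length $2k$ is a lattice path made of $2k$ steps, each either a rise $(1,1)$ or a fall $(1,-1)$, starting at $(0,0)$, ending at $(2k,0)$, and never going below the $x$-axis. Its vertices are the $2k+1$ lattice points $(j,y_j)$, $j=0,\dots,2k$, visited by the path; the altitude of a vertex is its $y$-coordinate. $|\mathcal{D}_k|=C_k$. -}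

module Defs where

open import Data.Bool using (Bool; true; false; _∧_; if_then_else_)
open import Data.Nat using (ℕ; zero; suc; _+_; _*_; _/_; _≤_)
open import Data.Nat.Combinatorics using (_C_)
open import Data.Integer as ℤ using (ℤ; +_; 0ℤ; 1ℤ; -1ℤ)
open import Data.List using (List; []; _∷_; map; scanl; filterᵇ; length; upTo; concatMap; last; _++_)
open import Data.Bool.ListAction using (and)
open import Data.Nat.ListAction using (sum)
open import Data.Maybe using (Maybe; just; nothing)
open import Relation.Nullary.Decidable using (⌊_⌋)
open import Data.Rational as ℚ using (ℚ)

-- A lattice path is a list of steps: true = rise (1,1), false = fall (1,-1).
Path : Set
Path = List Bool

step : ℤ → Bool → ℤ
step h true  = h ℤ.+ 1ℤ
step h false = h ℤ.- 1ℤ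

heights : Path → List ℤ
heights = scanl step 0ℤ

allPaths : ℕ → List Path
allPaths zero    = [] ∷ []
allPaths (suc n) = concatMap (λ p → (true ∷ p) ∷ (false ∷ p) ∷ []) (allPaths n)

endsAtZero : List ℤ → Bool
endsAtZero hs with last hs
... | just h  = ⌊ h ℤ.≟ 0ℤ ⌋
... | nothing = false

isDyck : Path → Bool
isDyck p = and (map (λ h → ⌊ 0ℤ ℤ.≤? h ⌋) (heights p)) ∧ endsAtZero (heights p)

dyck : ℕ → List Path
dyck k = filterᵇ isDyck (allPaths (2 * k))

V : ℕ → Path → ℕ
V i p = length (filterᵇ (λ h → ⌊ h ℤ.≟ + i ⌋) (heights p))

catalan : ℕ → ℕ
catalan m = ((2 * m) C m) / suc m

-- total division on ℚ from naturals (convention a/0 = 0; only used with nonzero denominators)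
divℚ : ℕ → ℕ → ℚ
divℚ a zero    = ℚ.0ℚ
divℚ a (suc b) = (+ a) ℚ./ suc b

Σℕ : {A : Set} → List A → (A → ℕ) → ℕ
Σℕ xs f = sum (map f xs)

Σℚ : {A : Set} → List A → (A → ℚ) → ℚ
Σℚ xs f = Data.List.foldr ℚ._+_ ℚ.0ℚ (map f xs)

range : ℕ → List ℕ
range k = upTo (suc k)

EV : ℕ → ℕ → ℚ
EV k i = divℚ (Σℕ (dyck k) (V i)) (length (dyck k))

normSqEV : ℕ → ℚ
normSqEV k = Σℚ (range k) (λ i → EV k i ℚ.* EV k i)

doubleSum : ℕ → ℕ
doubleSum k = Σℕ (dyck k) (λ p₁ → Σℕ (dyck k) (λ p₂ → Σℕ (range k) (λ i → V i p₁ * V i p₂)))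

{-# OPTIONS --safe #-}
module Submission where

-- Write W(n, a, b) for the number of ±1 walks of length n from a to b that never go
-- below 0. Summed over the Dyck paths of length 2k, the number of vertices at height i
-- is W(2k+1, 0, 2i+1): by first-step recursion, for nonnegative walks from any height m
-- to 0 this total plus the correction W(2k+1, m-1-i, i) (read as 0 when m ≤ i) equals
-- W(2k+1, m, 2i+1). Hence the double sum is Σ_i W(2k+1, 0, 2i+1)², which is W(4k+2, 0, 0)
-- by cutting walks of length 4k+2 at their midpoint: there the height is odd, and the
-- second half reversed is a walk from 0. By the reflection principle
-- W(2m, 0, 0) = C(2m, m) - C(2m, m+1) = C_m. The first identity only says that
-- E[V_i] = Σ_p V_i(p) / C_k.

open import Defs
import Algebra.Properties.CommutativeSemigroup
open import Data.Bool using (Bool; true; false; _∧_)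
open import Data.Bool.ListAction using (and)
open import Data.Bool.Properties using (∧-assoc)
open import Data.Integer as ℤ using (ℤ; -[1+_]; 0ℤ)
import Data.Integer.Properties as ℤ
import Data.Integer.Tactic.RingSolver as ℤ-Solver
open import Data.List using (List; []; _∷_; map; applyUpTo; upTo; filterᵇ; length; scanl; concatMap)
open import Data.List.Properties using (map-cong; map-applyUpTo)
open import Data.Nat using (ℕ; zero; suc; _+_; _*_; _∸_; _≡ᵇ_; _/_; _<_; _≤_; _≥_; s≤s; parity)
open import Data.Nat.Combinatorics using (_C_; nCk+nC[k+1]≡[n+1]C[k+1]; nC1≡n; k>n⇒nCk≡0)
open import Data.Nat.DivMod using (m*n/n≡m)
open import Data.Nat.ListAction using (sum)
open import Data.Nat.Properties
open import Data.Nat.Tactic.RingSolver using (solve-∀)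
open import Data.Parity.Base using (0ℙ; 1ℙ)
open import Data.Product using (_×_; _,_)
open import Data.Rational as ℚ using (0ℚ; fromℚᵘ)
import Data.Rational.Properties as ℚ
open import Data.Rational.Unnormalised as ℚᵘ using (mkℚᵘ; *≡*)
import Data.Rational.Unnormalised.Properties as ℚᵘ
open import Function using (id; _∘_)
open import Relation.Binary.PropositionalEquality
open import Relation.Nullary using (contradiction)
open import Relation.Nullary.Decidable using (⌊_⌋; isYes≗does)

open Algebra.Properties.CommutativeSemigroup +-commutativeSemigroup using (interchange)
open ≡-Reasoning

-- Kronecker delta and finite sums

⟦_⟧ : Bool → ℕ
⟦ true ⟧  = 1
⟦ false ⟧ = 0

δ : ℕ → ℕ → ℕ
δ m n = ⟦ m ≡ᵇ n ⟧

δ-refl : ∀ m → δ m m ≡ 1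
δ-refl zero    = refl
δ-refl (suc m) = δ-refl m

δ-≢ : ∀ {m n} → m ≢ n → δ m n ≡ 0
δ-≢ {zero}  {zero}  m≢n = contradiction refl m≢n
δ-≢ {zero}  {suc n} m≢n = refl
δ-≢ {suc m} {zero}  m≢n = refl
δ-≢ {suc m} {suc n} m≢n = δ-≢ (m≢n ∘ cong suc)

δ-sym : ∀ m n → δ m n ≡ δ n m
δ-sym zero    zero    = refl
δ-sym zero    (suc n) = refl
δ-sym (suc m) zero    = refl
δ-sym (suc m) (suc n) = δ-sym m n

δ-subst : ∀ m n (f : ℕ → ℕ) → δ m n * f m ≡ δ m n * f n
δ-subst zero    zero    f = refl
δ-subst zero    (suc n) f = refl
δ-subst (suc m) zero    f = refl
δ-subst (suc m) (suc n) f = δ-subst m n (f ∘ suc)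

∑< : ℕ → (ℕ → ℕ) → ℕ
∑< n f = sum (applyUpTo f n)

infixl 10 ∑<
syntax ∑< n (λ i → e) = ∑[ i < n ] e

∑-cong : ∀ n {f g : ℕ → ℕ} → (∀ i → f i ≡ g i) → ∑< n f ≡ ∑< n g
∑-cong zero    f≗g = refl
∑-cong (suc n) f≗g = cong₂ _+_ (f≗g 0) (∑-cong n (f≗g ∘ suc))

∑-+ : ∀ n (f g : ℕ → ℕ) → ∑[ i < n ] (f i + g i) ≡ ∑< n f + ∑< n g
∑-+ zero    f g = refl
∑-+ (suc n) f g = begin
  (f 0 + g 0) + ∑[ i < n ] (f (suc i) + g (suc i)) ≡⟨ cong ((f 0 + g 0) +_) (∑-+ n (f ∘ suc) (g ∘ suc)) ⟩
  (f 0 + g 0) + (∑< n (f ∘ suc) + ∑< n (g ∘ suc))  ≡⟨ interchange (f 0) (g 0) _ _ ⟩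
  ∑< (suc n) f + ∑< (suc n) g                      ∎

∑-zero : ∀ n → ∑[ i < n ] 0 ≡ 0
∑-zero zero    = refl
∑-zero (suc n) = ∑-zero n

∑-δ : ∀ n t (f : ℕ → ℕ) → t < n → ∑[ i < n ] (δ t i * f i) ≡ f t
∑-δ (suc n) zero    f _         = trans (cong₂ _+_ (+-identityʳ (f 0)) (∑-zero n)) (+-identityʳ (f 0))
∑-δ (suc n) (suc t) f (s≤s t<n) = ∑-δ n t (f ∘ suc) t<n

∑-even-odd : ∀ n (f : ℕ → ℕ) → ∑< (n + n) f ≡ ∑[ i < n ] (f (i + i) + f (suc (i + i)))
∑-even-odd zero    f = refl
∑-even-odd (suc n) f = begin
  ∑< (suc (n + suc n)) f                   ≡⟨ cong (λ m → ∑< (suc m) f) (+-suc n n) ⟩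
  f 0 + (f 1 + ∑< (n + n) (f ∘ suc ∘ suc)) ≡⟨ +-assoc (f 0) (f 1) _ ⟨
  (f 0 + f 1) + ∑< (n + n) (f ∘ suc ∘ suc) ≡⟨ cong ((f 0 + f 1) +_) (∑-even-odd n (f ∘ suc ∘ suc)) ⟩
  (f 0 + f 1) + ∑[ i < n ] (f (suc (suc (i + i))) + f (suc (suc (suc (i + i)))))
    ≡⟨ cong ((f 0 + f 1) +_) (∑-cong n (λ i → cong (λ j → f (suc j) + f (suc (suc j))) (sym (+-suc i i)))) ⟩
  ∑[ i < suc n ] (f (i + i) + f (suc (i + i))) ∎

Σ-cong : ∀ {A : Set} (xs : List A) {f g : A → ℕ} → (∀ x → f x ≡ g x) → Σℕ xs f ≡ Σℕ xs g
Σ-cong xs f≗g = cong sum (map-cong f≗g xs)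

Σ-+ : ∀ {A : Set} (xs : List A) (f g : A → ℕ) → Σℕ xs (λ x → f x + g x) ≡ Σℕ xs f + Σℕ xs g
Σ-+ []       f g = refl
Σ-+ (x ∷ xs) f g = trans (cong ((f x + g x) +_) (Σ-+ xs f g)) (interchange (f x) (g x) _ _)

Σ-*ˡ : ∀ {A : Set} (xs : List A) c (f : A → ℕ) → Σℕ xs (λ x → c * f x) ≡ c * Σℕ xs f
Σ-*ˡ []       c f = sym (*-zeroʳ c)
Σ-*ˡ (x ∷ xs) c f = trans (cong (c * f x +_) (Σ-*ˡ xs c f)) (sym (*-distribˡ-+ c (f x) _))

Σ-*ʳ : ∀ {A : Set} (xs : List A) c (f : A → ℕ) → Σℕ xs (λ x → f x * c) ≡ Σℕ xs f * c
Σ-*ʳ xs c f = trans (Σ-cong xs (λ x → *-comm (f x) c)) (trans (Σ-*ˡ xs c f) (*-comm c _))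

Σ-zero : ∀ {A : Set} (xs : List A) → Σℕ xs (λ _ → 0) ≡ 0
Σ-zero []       = refl
Σ-zero (x ∷ xs) = Σ-zero xs

Σ-swap : ∀ {A B : Set} (xs : List A) (ys : List B) (f : A → B → ℕ) →
         Σℕ xs (λ x → Σℕ ys (f x)) ≡ Σℕ ys (λ y → Σℕ xs (λ x → f x y))
Σ-swap []       ys f = sym (Σ-zero ys)
Σ-swap (x ∷ xs) ys f = trans (cong (Σℕ ys (f x) +_) (Σ-swap xs ys f))
                             (sym (Σ-+ ys (f x) (λ y → Σℕ xs (λ x′ → f x′ y))))

Σ-Σ*Σ : ∀ {A B C : Set} (xs : List A) (ys : List B) (zs : List C) (f : B → A → ℕ) (g : B → C → ℕ) →
        Σℕ ys (λ i → Σℕ xs (f i) * Σℕ zs (g i)) ≡ Σℕ xs (λ p → Σℕ zs (λ q → Σℕ ys (λ i → f i p * g i q)))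
Σ-Σ*Σ xs ys zs f g = begin
  Σℕ ys (λ i → Σℕ xs (f i) * Σℕ zs (g i))
    ≡⟨ Σ-cong ys (λ i → Σ-*ʳ xs _ (f i)) ⟨
  Σℕ ys (λ i → Σℕ xs (λ p → f i p * Σℕ zs (g i)))
    ≡⟨ Σ-cong ys (λ i → Σ-cong xs (λ p → Σ-*ˡ zs (f i p) (g i))) ⟨
  Σℕ ys (λ i → Σℕ xs (λ p → Σℕ zs (λ q → f i p * g i q)))
    ≡⟨ Σ-swap ys xs _ ⟩
  Σℕ xs (λ p → Σℕ ys (λ i → Σℕ zs (λ q → f i p * g i q)))
    ≡⟨ Σ-cong xs (λ p → Σ-swap ys zs _) ⟩
  Σℕ xs (λ p → Σℕ zs (λ q → Σℕ ys (λ i → f i p * g i q))) ∎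

Σ-upTo : ∀ n (f : ℕ → ℕ) → Σℕ (upTo n) f ≡ ∑< n f
Σ-upTo n f = cong sum (map-applyUpTo id f n)

length-filterᵇ-∷ : ∀ {A : Set} (P : A → Bool) x xs →
                   length (filterᵇ P (x ∷ xs)) ≡ ⟦ P x ⟧ + length (filterᵇ P xs)
length-filterᵇ-∷ P x xs with P x
... | true  = refl
... | false = refl

length-filterᵇ : ∀ {A : Set} (P : A → Bool) xs → length (filterᵇ P xs) ≡ Σℕ xs (λ x → ⟦ P x ⟧)
length-filterᵇ P []       = refl
length-filterᵇ P (x ∷ xs) = trans (length-filterᵇ-∷ P x xs) (cong (⟦ P x ⟧ +_) (length-filterᵇ P xs))

Σ-filterᵇ : ∀ {A : Set} (P : A → Bool) xs (f : A → ℕ) →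
            Σℕ (filterᵇ P xs) f ≡ Σℕ xs (λ x → ⟦ P x ⟧ * f x)
Σ-filterᵇ P []       f = refl
Σ-filterᵇ P (x ∷ xs) f with P x
... | true  = cong₂ _+_ (sym (+-identityʳ (f x))) (Σ-filterᵇ P xs f)
... | false = Σ-filterᵇ P xs f

-- Nonnegative walks

neighbourSum : (ℕ → ℕ) → ℕ → ℕ
neighbourSum f zero    = f 1
neighbourSum f (suc a) = f (suc (suc a)) + f a

neighbourSum-cong-≤ : ∀ a {f g : ℕ → ℕ} → (∀ c → c ≤ suc a → f c ≡ g c) →
                      neighbourSum f a ≡ neighbourSum g a
neighbourSum-cong-≤ zero    f≗g = f≗g 1 ≤-refl
neighbourSum-cong-≤ (suc a) f≗g =
  cong₂ _+_ (f≗g (suc (suc a)) ≤-refl) (f≗g a (≤-trans (n≤1+n a) (n≤1+n (suc a))))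

neighbourSum-cong : ∀ a {f g : ℕ → ℕ} → (∀ c → f c ≡ g c) → neighbourSum f a ≡ neighbourSum g a
neighbourSum-cong a f≗g = neighbourSum-cong-≤ a (λ c _ → f≗g c)

neighbourSum-zero : ∀ a → neighbourSum (λ _ → 0) a ≡ 0
neighbourSum-zero zero    = refl
neighbourSum-zero (suc a) = refl

neighbourSum-+ : ∀ (f g : ℕ → ℕ) a →
                 neighbourSum (λ c → f c + g c) a ≡ neighbourSum f a + neighbourSum g a
neighbourSum-+ f g zero    = refl
neighbourSum-+ f g (suc a) = interchange (f (suc (suc a))) (g (suc (suc a))) (f a) (g a)

neighbourSum-*ʳ : ∀ (f : ℕ → ℕ) x a → neighbourSum (λ c → f c * x) a ≡ neighbourSum f a * x
neighbourSum-*ʳ f x zero    = refl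
neighbourSum-*ʳ f x (suc a) = sym (*-distribʳ-+ x (f (suc (suc a))) (f a))

neighbourSum-∑ : ∀ n (g : ℕ → ℕ → ℕ) a →
                 neighbourSum (λ c → ∑< n (g c)) a ≡ ∑[ d < n ] neighbourSum (λ c → g c d) a
neighbourSum-∑ n g zero    = refl
neighbourSum-∑ n g (suc a) = sym (∑-+ n (g (suc (suc a))) (g a))

neighbourSum-comm : ∀ (g : ℕ → ℕ → ℕ) a b →
                    neighbourSum (λ c → neighbourSum (g c) b) a
                    ≡ neighbourSum (λ d → neighbourSum (λ c → g c d) a) b
neighbourSum-comm g zero    zero    = refl
neighbourSum-comm g zero    (suc b) = refl
neighbourSum-comm g (suc a) zero    = refl
neighbourSum-comm g (suc a) (suc b) =
  interchange (g (suc (suc a)) (suc (suc b))) (g (suc (suc a)) b) (g a (suc (suc b))) (g a b)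

-- walks n a b is the number of ±1 walks of length n from a to b that never go below 0.
walks : ℕ → ℕ → ℕ → ℕ
walks zero    a b = δ a b
walks (suc n) a b = neighbourSum (λ c → walks n c b) a

walks-last : ∀ n a b → walks (suc n) a b ≡ neighbourSum (walks n a) b
walks-last zero    zero    zero    = refl
walks-last zero    zero    (suc b) = refl
walks-last zero    (suc a) zero    = refl
walks-last zero    (suc a) (suc b) = +-comm (δ (suc a) b) (δ a (suc b))
walks-last (suc n) a       b       =
  trans (neighbourSum-cong a (λ c → walks-last n c b)) (neighbourSum-comm (walks n) a b)

walks-sym : ∀ n a b → walks n a b ≡ walks n b a
walks-sym zero    a b = δ-sym a b
walks-sym (suc n) a b = trans (neighbourSum-cong a (λ c → walks-sym n c b)) (sym (walks-last n b a))

walks-vanish : ∀ n a b → b + n < a → walks n a b ≡ 0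
walks-vanish zero    a       b b+0<a                = δ-≢ (>⇒≢ (≤-<-trans (m≤m+n b 0) b+0<a))
walks-vanish (suc n) (suc a) b (s≤s b+1+n<1+a) = cong₂ _+_
  (walks-vanish n (suc (suc a)) b (m<n⇒m<1+n (m<n⇒m<1+n b+n<a)))
  (walks-vanish n a b b+n<a)
  where
  b+n<a : b + n < a
  b+n<a = <-≤-trans (+-monoʳ-< b (n<1+n n)) b+1+n<1+a

walks-parity : ∀ n a b → parity (n + a) ≢ parity b → walks n a b ≡ 0
walks-parity zero    a       b p≢ = δ-≢ {a} {b} (p≢ ∘ cong parity)
walks-parity (suc n) zero    b p≢ = walks-parity n 1 b (p≢ ∘ trans (cong parity (sym (+-suc n 0))))
walks-parity (suc n) (suc a) b p≢ = cong₂ _+_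
  (walks-parity n (suc (suc a)) b (p≢ ∘ trans (cong parity (sym (+-suc n (suc a))))))
  (walks-parity n a b (p≢ ∘ trans (cong (parity ∘ suc) (+-suc n a))))

walks-+ : ∀ m n a b N → a + m < N → walks (m + n) a b ≡ ∑[ c < N ] (walks m a c * walks n c b)
walks-+ zero    n a b N a+0<N = sym (∑-δ N a (λ c → walks n c b) (≤-<-trans (m≤m+n a 0) a+0<N))
walks-+ (suc m) n a b N a+1+m<N = begin
  neighbourSum (λ c → walks (m + n) c b) a
    ≡⟨ neighbourSum-cong-≤ a (λ c c≤1+a → walks-+ m n c b N (≤-<-trans (c+m≤a+1+m c≤1+a) a+1+m<N)) ⟩
  neighbourSum (λ c → ∑[ d < N ] (walks m c d * walks n d b)) a
    ≡⟨ neighbourSum-∑ N (λ c d → walks m c d * walks n d b) a ⟩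
  ∑[ d < N ] neighbourSum (λ c → walks m c d * walks n d b) a
    ≡⟨ ∑-cong N (λ d → neighbourSum-*ʳ (λ c → walks m c d) (walks n d b) a) ⟩
  ∑[ d < N ] (walks (suc m) a d * walks n d b) ∎
  where
  c+m≤a+1+m : ∀ {c} → c ≤ suc a → c + m ≤ a + suc m
  c+m≤a+1+m c≤1+a = ≤-trans (+-monoˡ-≤ m c≤1+a) (≤-reflexive (sym (+-suc a m)))

walks-return : ∀ m N → m < N → walks (m + m) 0 0 ≡ ∑[ c < N ] (walks m 0 c * walks m 0 c)
walks-return m N m<N =
  trans (walks-+ m m 0 0 N m<N) (∑-cong N (λ c → cong (walks m 0 c *_) (walks-sym m c 0)))

parity-double : ∀ n → parity (n + n) ≡ 0ℙ
parity-double zero    = refl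
parity-double (suc n) = trans (cong (parity ∘ suc) (+-suc n n)) (parity-double n)

parity-double-suc : ∀ n → parity (suc (n + n)) ≡ 1ℙ
parity-double-suc zero    = refl
parity-double-suc (suc n) = trans (cong parity (+-suc n n)) (parity-double-suc n)

walks-return-odd : ∀ k → let m = suc (2 * k) in
                   walks (m + m) 0 0 ≡ ∑[ i < suc k ] (walks m 0 (suc (i + i)) * walks m 0 (suc (i + i)))
walks-return-odd k = begin
  walks (m + m) 0 0
    ≡⟨ walks-return m (suc k + suc k) m<2+2k ⟩
  ∑< (suc k + suc k) square
    ≡⟨ ∑-even-odd (suc k) square ⟩
  ∑[ i < suc k ] (square (i + i) + square (suc (i + i)))
    ≡⟨ ∑-cong (suc k) (λ i → cong (λ w → w * walks m 0 (i + i) + square (suc (i + i)))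
                                   (walks-parity m 0 (i + i) (odd≢even i))) ⟩
  ∑[ i < suc k ] square (suc (i + i)) ∎
  where
  m = suc (2 * k)
  square = λ c → walks m 0 c * walks m 0 c
  2k≡k+k : 2 * k ≡ k + k
  2k≡k+k = cong (k +_) (+-identityʳ k)
  m<2+2k : m < suc k + suc k
  m<2+2k = s≤s (≤-reflexive (trans (cong suc 2k≡k+k) (sym (+-suc k k))))
  odd≢even : ∀ i → parity (m + 0) ≢ parity (i + i)
  odd≢even i eq with trans (sym (parity-double-suc k))
                      (trans (cong (parity ∘ suc) (sym (trans (+-identityʳ (2 * k)) 2k≡k+k)))
                      (trans eq (parity-double i)))
  ... | ()

-- The reflection principle and Catalan numbers

[k+1]*[n+1]C[k+1]≡[n+1]*nCk : ∀ n k → suc k * (suc n C suc k) ≡ suc n * (n C k)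
[k+1]*[n+1]C[k+1]≡[n+1]*nCk n       zero    =
  trans (*-identityˡ (suc n C 1)) (trans (nC1≡n (suc n)) (sym (*-identityʳ (suc n))))
[k+1]*[n+1]C[k+1]≡[n+1]*nCk zero    (suc k) = *-zeroʳ (suc (suc k))
[k+1]*[n+1]C[k+1]≡[n+1]*nCk (suc n) (suc k) = begin
  suc (suc k) * (suc (suc n) C suc (suc k))
    ≡⟨ cong (suc (suc k) *_) (nCk+nC[k+1]≡[n+1]C[k+1] (suc n) (suc k)) ⟨
  suc (suc k) * (X + Y)
    ≡⟨ expand k X Y ⟩
  X + (suc k * X + suc (suc k) * Y)
    ≡⟨ cong₂ (λ u v → X + (u + v)) ([k+1]*[n+1]C[k+1]≡[n+1]*nCk n k) ([k+1]*[n+1]C[k+1]≡[n+1]*nCk n (suc k)) ⟩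
  X + (suc n * (n C k) + suc n * (n C suc k))
    ≡⟨ cong (X +_) (sym (*-distribˡ-+ (suc n) (n C k) (n C suc k))) ⟩
  X + suc n * (n C k + n C suc k)
    ≡⟨ cong (λ u → X + suc n * u) (nCk+nC[k+1]≡[n+1]C[k+1] n k) ⟩
  suc (suc n) * X ∎
  where
  X = suc n C suc k
  Y = suc n C suc (suc k)
  expand : ∀ k X Y → suc (suc k) * (X + Y) ≡ X + (suc k * X + suc (suc k) * Y)
  expand = solve-∀

[k+1]*nC[k+1]≡[n∸k]*nCk : ∀ n k → suc k * (n C suc k) ≡ (n ∸ k) * (n C k)
[k+1]*nC[k+1]≡[n∸k]*nCk n k = begin
  suc k * (n C suc k)                                     ≡⟨ m+n∸n≡m _ (suc k * (n C k)) ⟨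
  suc k * (n C suc k) + suc k * (n C k) ∸ suc k * (n C k) ≡⟨ cong (_∸ suc k * (n C k)) absorb ⟩
  suc n * (n C k) ∸ suc k * (n C k)                       ≡⟨ *-distribʳ-∸ (n C k) (suc n) (suc k) ⟨
  (n ∸ k) * (n C k)                                       ∎
  where
  absorb : suc k * (n C suc k) + suc k * (n C k) ≡ suc n * (n C k)
  absorb = begin
    suc k * (n C suc k) + suc k * (n C k) ≡⟨ +-comm _ (suc k * (n C k)) ⟩
    suc k * (n C k) + suc k * (n C suc k) ≡⟨ *-distribˡ-+ (suc k) (n C k) (n C suc k) ⟨
    suc k * (n C k + n C suc k)           ≡⟨ cong (suc k *_) (nCk+nC[k+1]≡[n+1]C[k+1] n k) ⟩
    suc k * (suc n C suc k)               ≡⟨ [k+1]*[n+1]C[k+1]≡[n+1]*nCk n k ⟩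
    suc n * (n C k)                       ∎

walks-reflection-step : ∀ n W₁ W₂ x y z → W₁ + n C suc x ≡ y → W₂ + n C x ≡ z →
                        (W₁ + W₂) + suc n C suc x ≡ y + z
walks-reflection-step n W₁ W₂ x y z eq₁ eq₂ = begin
  (W₁ + W₂) + suc n C suc x       ≡⟨ cong ((W₁ + W₂) +_) (nCk+nC[k+1]≡[n+1]C[k+1] n x) ⟨
  (W₁ + W₂) + (n C x + n C suc x) ≡⟨ cong ((W₁ + W₂) +_) (+-comm (n C x) (n C suc x)) ⟩
  (W₁ + W₂) + (n C suc x + n C x) ≡⟨ interchange W₁ W₂ (n C suc x) (n C x) ⟩
  (W₁ + n C suc x) + (W₂ + n C x) ≡⟨ cong₂ _+_ eq₁ eq₂ ⟩
  y + z                           ∎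

-- Of the n C u unconstrained walks from a to b with u up-steps, those touching -1 are,
-- by reflecting the part before the first visit, the walks from -2-a to b, which have
-- a + u + 1 up-steps.
walks-reflection : ∀ n a b u → a + (u + u) ≡ n + b → walks n a b + n C suc (a + u) ≡ n C u
walks-reflection zero    a       b zero    a+0≡b =
  trans (+-identityʳ (δ a b)) (trans (cong (δ a) (trans (sym a+0≡b) (+-identityʳ a))) (δ-refl a))
walks-reflection zero    a       b (suc u) a+2u≡b =
  trans (+-identityʳ (δ a b)) (δ-≢ (λ a≡b → m+1+n≢m a (trans a+2u≡b (sym a≡b))))
walks-reflection (suc n) zero    b zero    ()
walks-reflection (suc n) zero    b (suc u) 2u≡1+n+b = begin
  walks n 1 b + suc n C suc (suc u)       ≡⟨ cong (_+ suc n C suc (suc u)) (+-identityʳ (walks n 1 b)) ⟨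
  (walks n 1 b + 0) + suc n C suc (suc u) ≡⟨ walks-reflection-step n _ 0 (suc u) _ _ up refl ⟩
  n C u + n C suc u                       ≡⟨ nCk+nC[k+1]≡[n+1]C[k+1] n u ⟩
  suc n C suc u                           ∎
  where
  up : walks n 1 b + n C suc (suc u) ≡ n C u
  up = walks-reflection n 1 b u (trans (sym (+-suc u u)) (suc-injective 2u≡1+n+b))
walks-reflection (suc n) (suc a) b zero    1+a+0≡1+n+b =
  walks-reflection-step n _ _ (suc (a + 0)) 0 1
    (cong₂ _+_ (walks-vanish n (suc (suc a)) b b+n<2+a) (k>n⇒nCk≡0 n<2+a))
    (walks-reflection n a b 0 (suc-injective 1+a+0≡1+n+b))
  where
  b+n≡a : b + n ≡ a
  b+n≡a = trans (+-comm b n) (trans (sym (suc-injective 1+a+0≡1+n+b)) (+-identityʳ a))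
  b+n<2+a : b + n < suc (suc a)
  b+n<2+a = m<n⇒m<1+n (s≤s (≤-reflexive b+n≡a))
  n<2+a : n < suc (suc (a + 0))
  n<2+a = m<n⇒m<1+n (s≤s (≤-trans (m≤n+m n b) (≤-reflexive (trans b+n≡a (sym (+-identityʳ a))))))
walks-reflection (suc n) (suc a) b (suc u) e = begin
  walks (suc n) (suc a) b + suc n C suc (suc (a + suc u))
    ≡⟨ walks-reflection-step n _ _ (suc (a + suc u)) _ _ up down ⟩
  n C u + n C suc u
    ≡⟨ nCk+nC[k+1]≡[n+1]C[k+1] n u ⟩
  suc n C suc u ∎
  where
  shuffle : ∀ a u → suc (suc a) + (u + u) ≡ a + (suc u + suc u)
  shuffle = solve-∀
  up : walks n (suc (suc a)) b + n C suc (suc (a + suc u)) ≡ n C u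
  up = trans (cong (λ j → walks n (suc (suc a)) b + n C suc (suc j)) (+-suc a u))
             (walks-reflection n (suc (suc a)) b u (trans (shuffle a u) (suc-injective e)))
  down : walks n a b + n C suc (a + suc u) ≡ n C suc u
  down = walks-reflection n a b (suc u) (suc-injective e)

catalan≡walks : ∀ m → catalan m ≡ walks (2 * m) 0 0
catalan≡walks m = begin
  B / suc m           ≡⟨ cong (_/ suc m) (trans (sym [m+1]W≡B) (*-comm (suc m) W)) ⟩
  (W * suc m) / suc m ≡⟨ m*n/n≡m W (suc m) ⟩
  W                   ∎
  where
  B = 2 * m C m
  X = 2 * m C suc m
  W = walks (2 * m) 0 0
  W+X≡B : W + X ≡ B
  W+X≡B = walks-reflection (2 * m) 0 0 m (trans (cong (m +_) (sym (+-identityʳ m))) (sym (+-identityʳ (2 * m))))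
  [m+1]X≡mB : suc m * X ≡ m * B
  [m+1]X≡mB = trans ([k+1]*nC[k+1]≡[n∸k]*nCk (2 * m) m)
                    (cong (_* B) (trans (m+n∸m≡n m (m + 0)) (+-identityʳ m)))
  [m+1]W≡B : suc m * W ≡ B
  [m+1]W≡B = +-cancelʳ-≡ (m * B) _ _ (begin
    suc m * W + m * B     ≡⟨ cong (suc m * W +_) [m+1]X≡mB ⟨
    suc m * W + suc m * X ≡⟨ *-distribˡ-+ (suc m) W X ⟨
    suc m * (W + X)       ≡⟨ cong (suc m *_) W+X≡B ⟩
    B + m * B             ∎)

-- Visits to a given height

shift : ℕ → (ℕ → ℕ) → ℕ → ℕ
shift zero    f m       = f m
shift (suc s) f zero    = 0
shift (suc s) f (suc m) = shift s f m

shift-δ : ∀ s i m → shift s (λ a → δ a i) m ≡ δ m (s + i)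
shift-δ zero    i m       = refl
shift-δ (suc s) i zero    = refl
shift-δ (suc s) i (suc m) = shift-δ s i m

neighbourSum-shift-suc : ∀ s f m → neighbourSum (shift (suc s) f) (suc m) ≡ neighbourSum (shift s f) m
neighbourSum-shift-suc s f zero    = +-identityʳ (shift s f 1)
neighbourSum-shift-suc s f (suc m) = refl

neighbourSum-shift : ∀ s f m → shift s (neighbourSum f) m + δ (suc m) s * f 0 ≡ neighbourSum (shift s f) m
neighbourSum-shift zero          f m       = +-identityʳ (neighbourSum f m)
neighbourSum-shift (suc zero)    f zero    = +-identityʳ (f 0)
neighbourSum-shift (suc (suc s)) f zero    = refl
neighbourSum-shift (suc s)       f (suc m) =
  trans (neighbourSum-shift s f m) (sym (neighbourSum-shift-suc s f m))

-- visits (n + 1) m i is the total number of vertices at height i over all nonnegative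
-- walks of length n from m to 0; the index shift makes visits 0 vanish.
visits : ℕ → ℕ → ℕ → ℕ
visits zero    m i = 0
visits (suc n) m i = δ m i * walks n m 0 + neighbourSum (λ c → visits n c i) m

shift+visits≡walks : ∀ n m i → shift (suc i) (λ a → walks n a i) m + visits n m i ≡ walks n m (suc (i + i))
shift+visits≡walks zero    m i = trans (+-identityʳ _) (shift-δ (suc i) i m)
shift+visits≡walks (suc n) m i = begin
  R + (δ m i * walks n m 0 + U)        ≡⟨ +-assoc R _ U ⟨
  (R + δ m i * walks n m 0) + U        ≡⟨ cong (λ x → (R + x) + U) start ⟩
  (R + δ (suc m) (suc i) * f 0) + U    ≡⟨ cong (_+ U) (neighbourSum-shift (suc i) f m) ⟩
  neighbourSum (shift (suc i) f) m + U ≡⟨ neighbourSum-+ (shift (suc i) f) (λ c → visits n c i) m ⟨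
  neighbourSum (λ c → shift (suc i) f c + visits n c i) m
                                       ≡⟨ neighbourSum-cong m (λ c → shift+visits≡walks n c i) ⟩
  walks (suc n) m (suc (i + i))        ∎
  where
  f = λ a → walks n a i
  R = shift (suc i) (neighbourSum f) m
  U = neighbourSum (λ c → visits n c i) m
  start : δ m i * walks n m 0 ≡ δ m i * walks n 0 i
  start = trans (δ-subst m i (λ a → walks n a 0)) (cong (δ m i *_) (walks-sym n i 0))

-- Paths started at an arbitrary height

isDyckFrom : ℤ → Path → Bool
isDyckFrom h p = and (map (λ y → ⌊ 0ℤ ℤ.≤? y ⌋) (scanl step h p)) ∧ endsAtZero (scanl step h p)

VFrom : ℤ → ℕ → Path → ℕ
VFrom h i p = length (filterᵇ (λ y → ⌊ y ℤ.≟ ℤ.+ i ⌋) (scanl step h p))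

dyckCount : ℕ → ℤ → ℕ
dyckCount n h = Σℕ (allPaths n) (λ p → ⟦ isDyckFrom h p ⟧)

dyckVisits : ℕ → ℤ → ℕ → ℕ
dyckVisits n h i = Σℕ (allPaths n) (λ p → ⟦ isDyckFrom h p ⟧ * VFrom h i p)

⌊+≟+⌋ : ∀ m n → ⌊ ℤ.+ m ℤ.≟ ℤ.+ n ⌋ ≡ (m ≡ᵇ n)
⌊+≟+⌋ m n = isYes≗does (ℤ.+ m ℤ.≟ ℤ.+ n)

endsAtZero-∷ : ∀ y h p → endsAtZero (y ∷ scanl step h p) ≡ endsAtZero (scanl step h p)
endsAtZero-∷ y h []      = refl
endsAtZero-∷ y h (b ∷ p) = refl

isDyckFrom-∷ : ∀ h b p → isDyckFrom h (b ∷ p) ≡ ⌊ 0ℤ ℤ.≤? h ⌋ ∧ isDyckFrom (step h b) p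
isDyckFrom-∷ h b p = trans (cong ((nonneg h ∧ all-nonneg) ∧_) (endsAtZero-∷ h (step h b) p))
                           (∧-assoc (nonneg h) all-nonneg (endsAtZero (scanl step (step h b) p)))
  where
  nonneg = λ y → ⌊ 0ℤ ℤ.≤? y ⌋
  all-nonneg = and (map nonneg (scanl step (step h b) p))

isDyckFrom-[] : ∀ m → ⟦ isDyckFrom (ℤ.+ m) [] ⟧ ≡ δ m 0
isDyckFrom-[] m = cong ⟦_⟧ (⌊+≟+⌋ m 0)

isDyckFrom-neg : ∀ m p → isDyckFrom -[1+ m ] p ≡ false
isDyckFrom-neg m []      = refl
isDyckFrom-neg m (b ∷ p) = refl

VFrom-[] : ∀ m i → VFrom (ℤ.+ m) i [] ≡ δ m i
VFrom-[] m i = trans (length-filterᵇ-∷ (λ y → ⌊ y ℤ.≟ ℤ.+ i ⌋) (ℤ.+ m) [])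
                     (trans (+-identityʳ _) (cong ⟦_⟧ (⌊+≟+⌋ m i)))

VFrom-∷ : ∀ m i b p → VFrom (ℤ.+ m) i (b ∷ p) ≡ δ m i + VFrom (step (ℤ.+ m) b) i p
VFrom-∷ m i b p = trans (length-filterᵇ-∷ (λ y → ⌊ y ℤ.≟ ℤ.+ i ⌋) (ℤ.+ m) _)
                        (cong (λ x → ⟦ x ⟧ + VFrom (step (ℤ.+ m) b) i p) (⌊+≟+⌋ m i))

Σ-allPaths-suc : ∀ n (g : Path → ℕ) →
                 Σℕ (allPaths (suc n)) g ≡ Σℕ (allPaths n) (g ∘ (true ∷_)) + Σℕ (allPaths n) (g ∘ (false ∷_))
Σ-allPaths-suc n g = go (allPaths n)
  where
  go : ∀ ps → Σℕ (concatMap (λ p → (true ∷ p) ∷ (false ∷ p) ∷ []) ps) g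
              ≡ Σℕ ps (g ∘ (true ∷_)) + Σℕ ps (g ∘ (false ∷_))
  go []       = refl
  go (p ∷ ps) = trans (cong (λ x → g (true ∷ p) + (g (false ∷ p) + x)) (go ps))
                      (trans (sym (+-assoc (g (true ∷ p)) _ _)) (interchange (g (true ∷ p)) (g (false ∷ p)) _ _))

steps-neighbourSum : ∀ (F : ℤ → ℕ) → (∀ m → F -[1+ m ] ≡ 0) → ∀ m →
                     F (step (ℤ.+ m) true) + F (step (ℤ.+ m) false) ≡ neighbourSum (F ∘ ℤ.+_) m
steps-neighbourSum F F-neg zero    = trans (cong (F (ℤ.+ 1) +_) (F-neg 0)) (+-identityʳ (F (ℤ.+ 1)))
steps-neighbourSum F F-neg (suc m) = cong (λ x → F (ℤ.+ x) + F (ℤ.+ m)) (+-comm (suc m) 1)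

dyckCount-neg : ∀ n m → dyckCount n -[1+ m ] ≡ 0
dyckCount-neg n m = trans (Σ-cong (allPaths n) (cong ⟦_⟧ ∘ isDyckFrom-neg m)) (Σ-zero (allPaths n))

dyckVisits-neg : ∀ n i m → dyckVisits n -[1+ m ] i ≡ 0
dyckVisits-neg n i m =
  trans (Σ-cong (allPaths n) (λ p → cong (λ b → ⟦ b ⟧ * VFrom -[1+ m ] i p) (isDyckFrom-neg m p)))
        (Σ-zero (allPaths n))

dyckCount-suc : ∀ n m →
                dyckCount (suc n) (ℤ.+ m) ≡ dyckCount n (step (ℤ.+ m) true) + dyckCount n (step (ℤ.+ m) false)
dyckCount-suc n m = trans (Σ-allPaths-suc n (λ p → ⟦ isDyckFrom (ℤ.+ m) p ⟧))
  (cong₂ _+_ (Σ-cong (allPaths n) (cong ⟦_⟧ ∘ isDyckFrom-∷ (ℤ.+ m) true))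
             (Σ-cong (allPaths n) (cong ⟦_⟧ ∘ isDyckFrom-∷ (ℤ.+ m) false)))

dyckCount≡walks : ∀ n m → dyckCount n (ℤ.+ m) ≡ walks n m 0
dyckCount≡walks zero    m = trans (+-identityʳ _) (isDyckFrom-[] m)
dyckCount≡walks (suc n) m = begin
  dyckCount (suc n) (ℤ.+ m)
    ≡⟨ dyckCount-suc n m ⟩
  dyckCount n (step (ℤ.+ m) true) + dyckCount n (step (ℤ.+ m) false)
    ≡⟨ steps-neighbourSum (dyckCount n) (dyckCount-neg n) m ⟩
  neighbourSum (λ c → dyckCount n (ℤ.+ c)) m
    ≡⟨ neighbourSum-cong m (dyckCount≡walks n) ⟩
  walks (suc n) m 0 ∎

dyckVisits-∷ : ∀ n m i b →
               Σℕ (allPaths n) (λ p → ⟦ isDyckFrom (ℤ.+ m) (b ∷ p) ⟧ * VFrom (ℤ.+ m) i (b ∷ p))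
               ≡ δ m i * dyckCount n (step (ℤ.+ m) b) + dyckVisits n (step (ℤ.+ m) b) i
dyckVisits-∷ n m i b = begin
  Σℕ (allPaths n) (λ p → ⟦ isDyckFrom (ℤ.+ m) (b ∷ p) ⟧ * VFrom (ℤ.+ m) i (b ∷ p))
    ≡⟨ Σ-cong (allPaths n) (λ p → cong₂ (λ x y → ⟦ x ⟧ * y) (isDyckFrom-∷ (ℤ.+ m) b p) (VFrom-∷ m i b p)) ⟩
  Σℕ (allPaths n) (λ p → ok p * (δ m i + VFrom h i p))
    ≡⟨ Σ-cong (allPaths n) (λ p → trans (*-distribˡ-+ (ok p) (δ m i) _)
                                         (cong (_+ ok p * VFrom h i p) (*-comm (ok p) (δ m i)))) ⟩
  Σℕ (allPaths n) (λ p → δ m i * ok p + ok p * VFrom h i p)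
    ≡⟨ Σ-+ (allPaths n) _ _ ⟩
  Σℕ (allPaths n) (λ p → δ m i * ok p) + dyckVisits n h i
    ≡⟨ cong (_+ dyckVisits n h i) (Σ-*ˡ (allPaths n) (δ m i) ok) ⟩
  δ m i * dyckCount n h + dyckVisits n h i ∎
  where
  h = step (ℤ.+ m) b
  ok = λ p → ⟦ isDyckFrom h p ⟧

dyckVisits-suc : ∀ n m i →
                 dyckVisits (suc n) (ℤ.+ m) i
                 ≡ δ m i * dyckCount (suc n) (ℤ.+ m)
                   + (dyckVisits n (step (ℤ.+ m) true) i + dyckVisits n (step (ℤ.+ m) false) i)
dyckVisits-suc n m i = begin
  dyckVisits (suc n) (ℤ.+ m) i
    ≡⟨ Σ-allPaths-suc n (λ p → ⟦ isDyckFrom (ℤ.+ m) p ⟧ * VFrom (ℤ.+ m) i p) ⟩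
  _
    ≡⟨ cong₂ _+_ (dyckVisits-∷ n m i true) (dyckVisits-∷ n m i false) ⟩
  (δ m i * dyckCount n hT + dyckVisits n hT i) + (δ m i * dyckCount n hF + dyckVisits n hF i)
    ≡⟨ interchange (δ m i * dyckCount n hT) _ _ _ ⟩
  (δ m i * dyckCount n hT + δ m i * dyckCount n hF) + (dyckVisits n hT i + dyckVisits n hF i)
    ≡⟨ cong (_+ (dyckVisits n hT i + dyckVisits n hF i))
            (trans (sym (*-distribˡ-+ (δ m i) _ _)) (cong (δ m i *_) (sym (dyckCount-suc n m)))) ⟩
  δ m i * dyckCount (suc n) (ℤ.+ m) + (dyckVisits n hT i + dyckVisits n hF i) ∎
  where
  hT = step (ℤ.+ m) true
  hF = step (ℤ.+ m) false

dyckVisits≡visits : ∀ n m i → dyckVisits n (ℤ.+ m) i ≡ visits (suc n) m i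
dyckVisits≡visits zero    m i = begin
  ⟦ isDyckFrom (ℤ.+ m) [] ⟧ * VFrom (ℤ.+ m) i [] + 0 ≡⟨ +-identityʳ _ ⟩
  ⟦ isDyckFrom (ℤ.+ m) [] ⟧ * VFrom (ℤ.+ m) i []     ≡⟨ cong₂ _*_ (isDyckFrom-[] m) (VFrom-[] m i) ⟩
  δ m 0 * δ m i                                      ≡⟨ *-comm (δ m 0) (δ m i) ⟩
  δ m i * δ m 0                                      ≡⟨ +-identityʳ _ ⟨
  δ m i * δ m 0 + 0                                  ≡⟨ cong (δ m i * δ m 0 +_) (neighbourSum-zero m) ⟨
  visits 1 m i                                       ∎
dyckVisits≡visits (suc n) m i = begin
  dyckVisits (suc n) (ℤ.+ m) i
    ≡⟨ dyckVisits-suc n m i ⟩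
  δ m i * dyckCount (suc n) (ℤ.+ m) + (dyckVisits n (step (ℤ.+ m) true) i + dyckVisits n (step (ℤ.+ m) false) i)
    ≡⟨ cong₂ (λ x y → δ m i * x + y) (dyckCount≡walks (suc n) m)
                                     (steps-neighbourSum (λ h → dyckVisits n h i) (dyckVisits-neg n i) m) ⟩
  δ m i * walks (suc n) m 0 + neighbourSum (λ c → dyckVisits n (ℤ.+ c) i) m
    ≡⟨ cong (δ m i * walks (suc n) m 0 +_) (neighbourSum-cong m (λ c → dyckVisits≡visits n c i)) ⟩
  visits (suc (suc n)) m i ∎

Σ-dyck-V : ∀ k i → Σℕ (dyck k) (V i) ≡ walks (suc (2 * k)) 0 (suc (i + i))
Σ-dyck-V k i = begin
  Σℕ (dyck k) (V i)                   ≡⟨ Σ-filterᵇ isDyck (allPaths (2 * k)) (V i) ⟩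
  dyckVisits (2 * k) 0ℤ i             ≡⟨ dyckVisits≡visits (2 * k) 0 i ⟩
  visits (suc (2 * k)) 0 i            ≡⟨ shift+visits≡walks (suc (2 * k)) 0 i ⟩
  walks (suc (2 * k)) 0 (suc (i + i)) ∎

length-dyck : ∀ k → length (dyck k) ≡ catalan k
length-dyck k = begin
  length (dyck k)      ≡⟨ length-filterᵇ isDyck (allPaths (2 * k)) ⟩
  dyckCount (2 * k) 0ℤ ≡⟨ dyckCount≡walks (2 * k) 0 ⟩
  walks (2 * k) 0 0    ≡⟨ catalan≡walks k ⟨
  catalan k            ∎

doubleSum≡catalan : ∀ k → doubleSum k ≡ catalan (2 * k + 1)
doubleSum≡catalan k = begin
  doubleSum k
    ≡⟨ Σ-Σ*Σ (dyck k) (range k) (dyck k) V V ⟨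
  Σℕ (range k) (λ i → Σℕ (dyck k) (V i) * Σℕ (dyck k) (V i))
    ≡⟨ Σ-upTo (suc k) _ ⟩
  ∑[ i < suc k ] (Σℕ (dyck k) (V i) * Σℕ (dyck k) (V i))
    ≡⟨ ∑-cong (suc k) (λ i → cong₂ _*_ (Σ-dyck-V k i) (Σ-dyck-V k i)) ⟩
  ∑[ i < suc k ] (walks m 0 (suc (i + i)) * walks m 0 (suc (i + i)))
    ≡⟨ walks-return-odd k ⟨
  walks (m + m) 0 0
    ≡⟨ cong (λ n → walks n 0 0) (m+m≡2[2k+1] k) ⟩
  walks (2 * (2 * k + 1)) 0 0
    ≡⟨ catalan≡walks (2 * k + 1) ⟨
  catalan (2 * k + 1) ∎
  where
  m = suc (2 * k)
  m+m≡2[2k+1] : ∀ k → suc (2 * k) + suc (2 * k) ≡ 2 * (2 * k + 1)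
  m+m≡2[2k+1] = solve-∀

-- Rational arithmetic

fromℚᵘ-homo-* : ∀ p q → fromℚᵘ (p ℚᵘ.* q) ≡ fromℚᵘ p ℚ.* fromℚᵘ q
fromℚᵘ-homo-* p q = ℚ.toℚᵘ-injective (ℚᵘ.≃-trans (ℚ.toℚᵘ-fromℚᵘ (p ℚᵘ.* q)) (ℚᵘ.≃-sym (ℚᵘ.≃-trans
  (ℚ.toℚᵘ-homo-* (fromℚᵘ p) (fromℚᵘ q))
  (ℚᵘ.*-cong (ℚ.toℚᵘ-fromℚᵘ p) (ℚ.toℚᵘ-fromℚᵘ q)))))

fromℚᵘ-homo-+ : ∀ p q → fromℚᵘ (p ℚᵘ.+ q) ≡ fromℚᵘ p ℚ.+ fromℚᵘ q
fromℚᵘ-homo-+ p q = ℚ.toℚᵘ-injective (ℚᵘ.≃-trans (ℚ.toℚᵘ-fromℚᵘ (p ℚᵘ.+ q)) (ℚᵘ.≃-sym (ℚᵘ.≃-trans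
  (ℚ.toℚᵘ-homo-+ (fromℚᵘ p) (fromℚᵘ q))
  (ℚᵘ.+-cong (ℚ.toℚᵘ-fromℚᵘ p) (ℚ.toℚᵘ-fromℚᵘ q)))))

mkℚᵘ-+ : ∀ a b l → mkℚᵘ (ℤ.+ a) l ℚᵘ.+ mkℚᵘ (ℤ.+ b) l ℚᵘ.≃ mkℚᵘ (ℤ.+ (a + b)) l
mkℚᵘ-+ a b l = *≡* (begin
  (ℤ.+ a ℤ.* ℤ.+ L ℤ.+ ℤ.+ b ℤ.* ℤ.+ L) ℤ.* ℤ.+ L ≡⟨ common-denominator (ℤ.+ a) (ℤ.+ b) (ℤ.+ L) ⟩
  (ℤ.+ a ℤ.+ ℤ.+ b) ℤ.* (ℤ.+ L ℤ.* ℤ.+ L)         ≡⟨ cong₂ ℤ._*_ (ℤ.pos-+ a b) (ℤ.pos-* L L) ⟨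
  ℤ.+ (a + b) ℤ.* ℤ.+ (L * L)                     ∎)
  where
  L = suc l
  common-denominator : ∀ x y d → (x ℤ.* d ℤ.+ y ℤ.* d) ℤ.* d ≡ (x ℤ.+ y) ℤ.* (d ℤ.* d)
  common-denominator = ℤ-Solver.solve-∀

divℚ-zero : ∀ l → divℚ 0 l ≡ 0ℚ
divℚ-zero zero    = refl
divℚ-zero (suc l) = ℚ.0/n≡0 (suc l)

divℚ-* : ∀ a b l → divℚ a l ℚ.* divℚ b l ≡ divℚ (a * b) (l * l)
divℚ-* a b zero    = refl
divℚ-* a b (suc l) = trans (sym (fromℚᵘ-homo-* (mkℚᵘ (ℤ.+ a) l) (mkℚᵘ (ℤ.+ b) l)))
                           (cong (λ z → fromℚᵘ (mkℚᵘ z (l + l * suc l))) (sym (ℤ.pos-* a b)))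

divℚ-+ : ∀ a b l → divℚ a l ℚ.+ divℚ b l ≡ divℚ (a + b) l
divℚ-+ a b zero    = refl
divℚ-+ a b (suc l) = trans (sym (fromℚᵘ-homo-+ (mkℚᵘ (ℤ.+ a) l) (mkℚᵘ (ℤ.+ b) l)))
                           (ℚ.fromℚᵘ-cong (mkℚᵘ-+ a b l))

Σℚ-divℚ-* : ∀ {A : Set} (xs : List A) (f g : A → ℕ) l →
            Σℚ xs (λ x → divℚ (f x) l ℚ.* divℚ (g x) l) ≡ divℚ (Σℕ xs (λ x → f x * g x)) (l * l)
Σℚ-divℚ-* []       f g l = sym (divℚ-zero (l * l))
Σℚ-divℚ-* (x ∷ xs) f g l =
  trans (cong₂ ℚ._+_ (divℚ-* (f x) (g x) l) (Σℚ-divℚ-* xs f g l)) (divℚ-+ _ _ (l * l))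

theorem2 : (k : ℕ) → k ≥ 1 →
    (normSqEV k ≡ divℚ (doubleSum k) (catalan k * catalan k))
    × (divℚ (doubleSum k) (catalan k * catalan k) ≡ divℚ (catalan (2 * k + 1)) (catalan k * catalan k))
theorem2 k _ =
  trans (Σℚ-divℚ-* (range k) S S (length (dyck k)))
        (cong₂ divℚ (Σ-Σ*Σ (dyck k) (range k) (dyck k) V V) (cong₂ _*_ (length-dyck k) (length-dyck k)))
  , cong (λ s → divℚ s (catalan k * catalan k)) (doubleSum≡catalan k)
  where
  S = λ i → Σℕ (dyck k) (V i)
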